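{- For every $n\in\mathbb{N}$ (with $n\ge 1$), the domination polynomial of the generalized book graph $B_{n,5}$ is \[ D(B_{n,5},x)=x^2(x+1)^{2n+1}-2x^{n+1}+(x^2+2x)^n(2x^2+3x). \]
   Context: All graphs are finite and simple. For a graph $G=(V,E)$, a set $S\subseteq V$ is dominating if every vertex of $V\setminus S$ is adjacent to a vertex of $S$. Let $d(G,i)$ be the number of dominating sets of $G$ of size $i$; the domination polynomial is $D(G,x)=\sum_{i=\gamma(G)}^{|V|} d(G,i)x^i$, where $\gamma(G)$ is the minimum size of a dominating set. The generalized book graph $B_{n,5}$ has vertex set $\{u_1,u_2,u_3\}\cup\{v_i,w_i:1\le i\le n\}$ and edge set $\{u_1u_2,u_2u_3\}\cup\{u_3w_i:1\le i\le n\}\cup\{u_1v_i:1\le i\le n\}\cup\{v_iw_i:1\le i\le n\}$; that is, $n$ copies of the $5$-cycle $C_5$ sharing the common path $u_1u_2u_3$. -}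

module Defs where

open import Data.Bool using (Bool; true; false; _∧_; _∨_; if_then_else_)
open import Data.Nat as ℕ using (ℕ; zero; suc; _≡ᵇ_)
open import Data.Fin using (Fin; toℕ)
open import Data.Vec using (Vec; []; _∷_; lookup)
open import Data.List using (List; []; _∷_; _++_; map; length; filterᵇ; upTo; foldr)
open import Data.Bool.ListAction using (any)
open import Data.Integer as ℤ using (ℤ; +_)

record Graph : Set where
  field
    order  : ℕ
    adj    : Fin order → Fin order → Bool
open Graph public

VSet : ℕ → Set
VSet m = Vec Bool m

allSubsets : (m : ℕ) → List (VSet m)
allSubsets zero    = [] ∷ []
allSubsets (suc m) = map (true ∷_) (allSubsets m) ++ map (false ∷_) (allSubsets m)

size : ∀ {m} → VSet m → ℕ
size []          = 0
size (true  ∷ s) = suc (size s)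
size (false ∷ s) = size s

allFin : (m : ℕ) → List (Fin m)
allFin m = Data.List.tabulate {n = m} (λ i → i)
  where import Data.List

allᵇ : ∀ {A : Set} → (A → Bool) → List A → Bool
allᵇ p = foldr (λ a b → p a ∧ b) true

isDominating : (G : Graph) → VSet (order G) → Bool
isDominating G S =
  allᵇ (λ v → lookup S v ∨ any (λ u → lookup S u ∧ adj G u v) (allFin (order G)))
       (allFin (order G))

d : Graph → ℕ → ℕ
d G i = length (filterᵇ (λ S → isDominating G S ∧ (size S ≡ᵇ i)) (allSubsets (order G)))

sumTo : ℕ → (ℕ → ℤ) → ℤ
sumTo zero    f = f 0
sumTo (suc k) f = sumTo k f ℤ.+ f (suc k)

-- Domination polynomial D(G,x) = Σ_i d(G,i) x^i, evaluated at x ∈ ℤ.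
-- (d(G,i) = 0 for i < γ(G), so summing from 0 to |V| is the same.)
D : Graph → ℤ → ℤ
D G x = sumTo (order G) (λ i → (+ d G i) ℤ.* (x ℤ.^ i))

-- Generalized book graph B_{n,5}, vertices numbered
--   u₁ = 0, u₂ = 1, u₃ = 2, v_i = 3 + i, w_i = 3 + n + i   (0 ≤ i < n).

bookEdge : ℕ → ℕ → ℕ → Bool
bookEdge n a b =
     ((a ≡ᵇ 0) ∧ (b ≡ᵇ 1))
  ∨ ((a ≡ᵇ 1) ∧ (b ≡ᵇ 2))
  ∨ any (λ i → ((a ≡ᵇ 2) ∧ (b ≡ᵇ 3 ℕ.+ n ℕ.+ i))
             ∨ ((a ≡ᵇ 0) ∧ (b ≡ᵇ 3 ℕ.+ i))
             ∨ ((a ≡ᵇ 3 ℕ.+ i) ∧ (b ≡ᵇ 3 ℕ.+ n ℕ.+ i)))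
        (upTo n)

B5 : ℕ → Graph
B5 n = record
  { order = 3 ℕ.+ n ℕ.+ n
  ; adj   = λ a b → bookEdge n (toℕ a) (toℕ b) ∨ bookEdge n (toℕ b) (toℕ a)
  }

-- Write a vertex set S of B_{n,5} as (a, b, c) = S ∩ (u₁, u₂, u₃) together with the n spoke
-- pairs (vᵢ, wᵢ). S is dominating iff a ∨ b ∨ c, u₁ is dominated by a, b or some vᵢ, u₃ by c,
-- b or some wᵢ, and every spoke u₁ vᵢ wᵢ u₃ has both vᵢ and wᵢ dominated; the last condition
-- only involves a, c and that spoke. So for fixed (a, b, c) the generating function of the
-- spoke configurations is the n-th power of a one-spoke weight: (x + 1)² if a and c hold,
-- x² + 2x otherwise. The requirement "some vᵢ ∈ S" is met by subtracting the configurations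
-- with no vᵢ, whose one-spoke weight is x (and symmetrically for wᵢ).

module Submission where

open import Data.Bool using (Bool; true; false; not; _∧_; _∨_; T; if_then_else_)
open import Data.Bool.ListAction using (any)
open import Data.Bool.Properties using (T-∧; T-∨)
open import Data.Empty using (⊥-elim)
open import Data.Fin as Fin using (Fin; toℕ; splitAt; _↑ˡ_; _↑ʳ_)
open import Data.Fin.Properties using (toℕ-↑ˡ; toℕ-↑ʳ; toℕ<n; toℕ-injective; splitAt⁻¹-↑ˡ; splitAt⁻¹-↑ʳ)
open import Data.Integer using (ℤ; +_; _+_; _-_; _*_; _^_)
import Data.Integer.Properties as ℤ
open import Data.Integer.Tactic.RingSolver using (solve-∀)
open import Data.List as List using (List; []; _∷_; map; tabulate; filterᵇ; length; upTo)
open import Data.List.Membership.Propositional using (find; lose)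
open import Data.List.Membership.Propositional.Properties using (∈-upTo⁺; ∈-upTo⁻)
open import Data.List.Relation.Unary.Any.Properties using (any⁺; any⁻; tabulate⁺; tabulate⁻)
open import Data.Nat as ℕ using (ℕ; zero; suc; _≡ᵇ_; _<ᵇ_; _<_; _≤_; _≥_; _∸_; z≤n; s≤s)
import Data.Nat.Properties as ℕ
import Data.Nat
open import Data.Product using (∃; ∃-syntax; _×_; _,_; proj₁; proj₂)
open import Data.Sum as Sum using (_⊎_; inj₁; inj₂)
open import Data.Unit using (tt)
open import Data.Vec as Vec using (Vec; []; _∷_; lookup)
open import Data.Vec.Properties using (lookup-++ˡ; lookup-++ʳ)
open import Function using (_∘_; _⟨_⟩_; _⇔_; mk⇔; Equivalence)
open import Relation.Binary.PropositionalEquality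
open Equivalence using (to; from)

open import Defs

T-⇔⇒≡ : ∀ {p q} → (T p ⇔ T q) → p ≡ q
T-⇔⇒≡ {false} {false} _   = refl
T-⇔⇒≡ {false} {true}  p⇔q = ⊥-elim (from p⇔q tt)
T-⇔⇒≡ {true}  {false} p⇔q = ⊥-elim (to p⇔q tt)
T-⇔⇒≡ {true}  {true}  _   = refl

T-∨₃ : ∀ {p q r} → T (p ∨ q ∨ r) ⇔ (T p ⊎ T q ⊎ T r)
T-∨₃ = mk⇔ (Sum.map₂ (to T-∨) ∘ to T-∨) (from T-∨ ∘ Sum.map₂ (from T-∨))

T-∧-≡ᵇ : ∀ a p b q → T ((a ≡ᵇ p) ∧ (b ≡ᵇ q)) → a ≡ p × b ≡ q
T-∧-≡ᵇ a p b q h = let a≡p , b≡q = to T-∧ h in ℕ.≡ᵇ⇒≡ a p a≡p , ℕ.≡ᵇ⇒≡ b q b≡q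

≡ᵇ-refl : ∀ k → T (k ≡ᵇ k)
≡ᵇ-refl k = ℕ.≡⇒≡ᵇ k k refl

∧-swap : ∀ p q r → p ∧ (q ∧ r) ≡ q ∧ (p ∧ r)
∧-swap true  q     r = refl
∧-swap false true  r = refl
∧-swap false false r = refl

T-allᵇ-tabulate : ∀ {A : Set} {m} {p : A → Bool} {g : Fin m → A} →
                  T (allᵇ p (tabulate g)) ⇔ (∀ i → T (p (g i)))
T-allᵇ-tabulate {m = m} = mk⇔ (elim m) (intro m)
  where
  elim : ∀ {A} {p : A → Bool} m {g : Fin m → A} → T (allᵇ p (tabulate g)) → ∀ i → T (p (g i))
  elim (suc m) h Fin.zero    = proj₁ (to T-∧ h)
  elim (suc m) h (Fin.suc i) = elim m (proj₂ (to T-∧ h)) i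
  intro : ∀ {A} {p : A → Bool} m {g : Fin m → A} → (∀ i → T (p (g i))) → T (allᵇ p (tabulate g))
  intro zero    h = tt
  intro (suc m) h = from T-∧ (h Fin.zero , intro m (h ∘ Fin.suc))

⟦_⟧ : Bool → ℤ
⟦ true  ⟧ = + 1
⟦ false ⟧ = + 0

⟦∧⟧ : ∀ p q → ⟦ p ∧ q ⟧ ≡ ⟦ p ⟧ * ⟦ q ⟧
⟦∧⟧ true  true  = refl
⟦∧⟧ true  false = refl
⟦∧⟧ false true  = refl
⟦∧⟧ false false = refl

⟦∧⟧-complement : ∀ a p y → ⟦ a ∧ p ⟧ * y ≡ ⟦ p ⟧ * y - ⟦ not a ∧ p ⟧ * y
⟦∧⟧-complement a p y = cong (_* y) (table a p) ⟨ trans ⟩ distrib ⟦ p ⟧ ⟦ not a ∧ p ⟧ y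
  where
  table : ∀ a p → ⟦ a ∧ p ⟧ ≡ ⟦ p ⟧ - ⟦ not a ∧ p ⟧
  table true  true  = refl
  table true  false = refl
  table false true  = refl
  table false false = refl
  distrib : ∀ p q y → (p - q) * y ≡ p * y - q * y
  distrib = solve-∀

∑ : ∀ {A : Set} → List A → (A → ℤ) → ℤ
∑ []       f = + 0
∑ (a ∷ as) f = f a + ∑ as f

∑𝔹 : (Bool → ℤ) → ℤ
∑𝔹 f = f true + f false

module _ {A : Set} where

  ∑-cong : ∀ (as : List A) {f g : A → ℤ} → (∀ a → f a ≡ g a) → ∑ as f ≡ ∑ as g
  ∑-cong []       f≡g = refl
  ∑-cong (a ∷ as) f≡g = cong₂ _+_ (f≡g a) (∑-cong as f≡g)

  ∑-zero : ∀ (as : List A) {f : A → ℤ} → (∀ a → f a ≡ + 0) → ∑ as f ≡ + 0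
  ∑-zero []       f≡0 = refl
  ∑-zero (a ∷ as) f≡0 = cong₂ _+_ (f≡0 a) (∑-zero as f≡0)

  ∑-++ : ∀ (as bs : List A) f → ∑ (as List.++ bs) f ≡ ∑ as f + ∑ bs f
  ∑-++ []       bs f = sym (ℤ.+-identityˡ _)
  ∑-++ (a ∷ as) bs f = cong (λ s → f a + s) (∑-++ as bs f) ⟨ trans ⟩ sym (ℤ.+-assoc (f a) _ _)

  ∑-map : ∀ {B : Set} (g : B → A) (bs : List B) f → ∑ (map g bs) f ≡ ∑ bs (f ∘ g)
  ∑-map g []       f = refl
  ∑-map g (b ∷ bs) f = cong (λ s → f (g b) + s) (∑-map g bs f)

  ∑-+ : ∀ (as : List A) (f g : A → ℤ) → ∑ as (λ a → f a + g a) ≡ ∑ as f + ∑ as g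
  ∑-+ []       f g = refl
  ∑-+ (a ∷ as) f g = cong (λ s → f a + g a + s) (∑-+ as f g) ⟨ trans ⟩ swap (f a) (g a) (∑ as f) (∑ as g)
    where
    swap : ∀ p q r s → p + q + (r + s) ≡ p + r + (q + s)
    swap = solve-∀

  ∑-- : ∀ (as : List A) (f g : A → ℤ) → ∑ as (λ a → f a - g a) ≡ ∑ as f - ∑ as g
  ∑-- []       f g = refl
  ∑-- (a ∷ as) f g = cong (λ s → f a - g a + s) (∑-- as f g) ⟨ trans ⟩ swap (f a) (g a) (∑ as f) (∑ as g)
    where
    swap : ∀ p q r s → p - q + (r - s) ≡ p + r - (q + s)
    swap = solve-∀

  ∑-* : ∀ (as : List A) (c : ℤ) (f : A → ℤ) → ∑ as (λ a → c * f a) ≡ c * ∑ as f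
  ∑-* []       c f = sym (ℤ.*-zeroʳ c)
  ∑-* (a ∷ as) c f = cong (λ s → c * f a + s) (∑-* as c f) ⟨ trans ⟩ sym (ℤ.*-distribˡ-+ c (f a) _)

  ∑-∑𝔹 : ∀ (as : List A) (f : A → Bool → ℤ) → ∑ as (λ a → ∑𝔹 (f a)) ≡ ∑𝔹 (λ b → ∑ as (λ a → f a b))
  ∑-∑𝔹 as f = ∑-+ as (λ a → f a true) (λ a → f a false)

∑𝔹-cong : ∀ {f g : Bool → ℤ} → (∀ b → f b ≡ g b) → ∑𝔹 f ≡ ∑𝔹 g
∑𝔹-cong f≡g = cong₂ _+_ (f≡g true) (f≡g false)

∑𝔹-*ʳ : ∀ (f : Bool → ℤ) q → ∑𝔹 (λ b → f b * q) ≡ ∑𝔹 f * q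
∑𝔹-*ʳ f q = sym (ℤ.*-distribʳ-+ q (f true) (f false))

∑-allSubsets-suc : ∀ m (f : VSet (suc m) → ℤ) →
                   ∑ (allSubsets (suc m)) f ≡ ∑𝔹 (λ b → ∑ (allSubsets m) (f ∘ (b ∷_)))
∑-allSubsets-suc m f =
  ∑-++ (map (true ∷_) (allSubsets m)) _ f
  ⟨ trans ⟩ cong₂ _+_ (∑-map (true ∷_) (allSubsets m) f) (∑-map (false ∷_) (allSubsets m) f)

∑-allSubsets-++ : ∀ p q (f : VSet (p ℕ.+ q) → ℤ) →
                  ∑ (allSubsets (p ℕ.+ q)) f ≡ ∑ (allSubsets p) (λ xs → ∑ (allSubsets q) (λ ys → f (xs Vec.++ ys)))
∑-allSubsets-++ zero    q f = sym (ℤ.+-identityʳ _)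
∑-allSubsets-++ (suc p) q f =
  ∑-allSubsets-suc (p ℕ.+ q) f
  ⟨ trans ⟩ ∑𝔹-cong (λ b → ∑-allSubsets-++ p q (f ∘ (b ∷_)))
  ⟨ trans ⟩ sym (∑-allSubsets-suc p _)

size-++ : ∀ {p q} (xs : VSet p) (ys : VSet q) → size (xs Vec.++ ys) ≡ size xs ℕ.+ size ys
size-++ []           ys = refl
size-++ (true  ∷ xs) ys = cong suc (size-++ xs ys)
size-++ (false ∷ xs) ys = size-++ xs ys

size≤ : ∀ {m} (S : VSet m) → size S ≤ m
size≤ []          = z≤n
size≤ (true  ∷ S) = s≤s (size≤ S)
size≤ (false ∷ S) = ℕ.m≤n⇒m≤1+n (size≤ S)

-- The domination polynomial as a sum over vertex sets

⟦≡ᵇ⟧-refl : ∀ k → ⟦ k ≡ᵇ k ⟧ ≡ + 1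
⟦≡ᵇ⟧-refl zero    = refl
⟦≡ᵇ⟧-refl (suc k) = ⟦≡ᵇ⟧-refl k

⟦≡ᵇ⟧-≢ : ∀ {k i} → k ≢ i → ⟦ k ≡ᵇ i ⟧ ≡ + 0
⟦≡ᵇ⟧-≢ {k} {i} k≢i with k ≡ᵇ i in eq
... | false = refl
... | true  = ⊥-elim (k≢i (ℕ.≡ᵇ⇒≡ k i (subst T (sym eq) tt)))

sumTo-cong : ∀ m {f g : ℕ → ℤ} → (∀ i → f i ≡ g i) → sumTo m f ≡ sumTo m g
sumTo-cong zero    f≡g = f≡g 0
sumTo-cong (suc m) f≡g = cong₂ _+_ (sumTo-cong m f≡g) (f≡g (suc m))

sumTo-zero : ∀ m {f : ℕ → ℤ} → (∀ i → f i ≡ + 0) → sumTo m f ≡ + 0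
sumTo-zero zero    f≡0 = f≡0 0
sumTo-zero (suc m) f≡0 = cong₂ _+_ (sumTo-zero m f≡0) (f≡0 (suc m))

sumTo-+ : ∀ m (f g : ℕ → ℤ) → sumTo m (λ i → f i + g i) ≡ sumTo m f + sumTo m g
sumTo-+ zero    f g = refl
sumTo-+ (suc m) f g =
  cong (_+ (f (suc m) + g (suc m))) (sumTo-+ m f g)
  ⟨ trans ⟩ swap (sumTo m f) (sumTo m g) (f (suc m)) (g (suc m))
  where
  swap : ∀ p q r s → p + q + (r + s) ≡ p + r + (q + s)
  swap = solve-∀

sumTo-⟦≡ᵇ⟧-< : ∀ {k} m (f : ℕ → ℤ) → m < k → sumTo m (λ i → ⟦ k ≡ᵇ i ⟧ * f i) ≡ + 0
sumTo-⟦≡ᵇ⟧-< zero    f 0<k   = cong (_* f 0) (⟦≡ᵇ⟧-≢ (ℕ.>⇒≢ 0<k))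
sumTo-⟦≡ᵇ⟧-< (suc m) f 1+m<k =
  cong₂ _+_ (sumTo-⟦≡ᵇ⟧-< m f (ℕ.<-trans (ℕ.n<1+n m) 1+m<k))
            (cong (_* f (suc m)) (⟦≡ᵇ⟧-≢ (ℕ.>⇒≢ 1+m<k)))

sumTo-⟦≡ᵇ⟧ : ∀ {k} m (f : ℕ → ℤ) → k ≤ m → sumTo m (λ i → ⟦ k ≡ᵇ i ⟧ * f i) ≡ f k
sumTo-⟦≡ᵇ⟧ {zero} zero f _ = ℤ.*-identityˡ (f 0)
sumTo-⟦≡ᵇ⟧ {k} (suc m) f k≤1+m with ℕ.m≤n⇒m<n∨m≡n k≤1+m
... | inj₁ k<1+m =
  cong₂ _+_ (sumTo-⟦≡ᵇ⟧ m f (ℕ.≤-pred k<1+m)) (cong (_* f (suc m)) (⟦≡ᵇ⟧-≢ (ℕ.<⇒≢ k<1+m)))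
  ⟨ trans ⟩ ℤ.+-identityʳ (f k)
... | inj₂ refl =
  cong₂ _+_ (sumTo-⟦≡ᵇ⟧-< m f (ℕ.n<1+n m)) (cong (_* f (suc m)) (⟦≡ᵇ⟧-refl (suc m)))
  ⟨ trans ⟩ ℤ.+-identityˡ _ ⟨ trans ⟩ ℤ.*-identityˡ (f (suc m))

+length-filterᵇ-∷ : ∀ {A : Set} (q : A → Bool) a as →
                    + length (filterᵇ q (a ∷ as)) ≡ ⟦ q a ⟧ + + length (filterᵇ q as)
+length-filterᵇ-∷ q a as with q a
... | true  = refl
... | false = sym (ℤ.+-identityˡ _)

sumTo-count : ∀ {m} (x : ℤ) (p : VSet m → Bool) (Ss : List (VSet m)) →
              sumTo m (λ i → + length (filterᵇ (λ S → p S ∧ (size S ≡ᵇ i)) Ss) * x ^ i)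
              ≡ ∑ Ss (λ S → ⟦ p S ⟧ * x ^ size S)
sumTo-count {m} x p []       = sumTo-zero m (λ _ → refl)
sumTo-count {m} x p (S ∷ Ss) = begin
    sumTo m (λ i → + length (filterᵇ (q i) (S ∷ Ss)) * x ^ i)
  ≡⟨ sumTo-cong m (λ i → cong (_* x ^ i) (+length-filterᵇ-∷ (q i) S Ss)
                         ⟨ trans ⟩ ℤ.*-distribʳ-+ (x ^ i) ⟦ q i S ⟧ _) ⟩
    sumTo m (λ i → ⟦ q i S ⟧ * x ^ i + + length (filterᵇ (q i) Ss) * x ^ i)
  ≡⟨ sumTo-+ m _ _ ⟩
    sumTo m (λ i → ⟦ q i S ⟧ * x ^ i) + sumTo m (λ i → + length (filterᵇ (q i) Ss) * x ^ i)
  ≡⟨ cong₂ _+_ single (sumTo-count x p Ss) ⟩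
    ⟦ p S ⟧ * x ^ size S + ∑ Ss (λ S → ⟦ p S ⟧ * x ^ size S)
  ∎
  where
  open ≡-Reasoning
  q : ℕ → VSet m → Bool
  q i S = p S ∧ (size S ≡ᵇ i)
  single : sumTo m (λ i → ⟦ q i S ⟧ * x ^ i) ≡ ⟦ p S ⟧ * x ^ size S
  single with p S
  ... | true  = sumTo-⟦≡ᵇ⟧ m (x ^_) (size≤ S) ⟨ trans ⟩ sym (ℤ.*-identityˡ _)
  ... | false = sumTo-zero m (λ _ → refl)

D≡∑dominating : ∀ G x → D G x ≡ ∑ (allSubsets (order G)) (λ S → ⟦ isDominating G S ⟧ * x ^ size S)
D≡∑dominating G x = sumTo-count x (isDominating G) (allSubsets (order G))

Dominated : (G : Graph) → VSet (order G) → Fin (order G) → Set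
Dominated G S v = T (lookup S v) ⊎ ∃[ u ] T (lookup S u) × T (adj G u v)

isDominating⇔ : ∀ G S → T (isDominating G S) ⇔ (∀ v → Dominated G S v)
isDominating⇔ G S = mk⇔ (λ h v → closed⇒ (to T-allᵇ-tabulate h v))
                        (λ h → from T-allᵇ-tabulate (λ v → ⇒closed (h v)))
  where
  closed⇒ : ∀ {v} → T (lookup S v ∨ any (λ u → lookup S u ∧ adj G u v) (allFin (order G))) → Dominated G S v
  closed⇒ = Sum.map₂ (λ h → let u , Su∧uv = tabulate⁻ (any⁻ _ _ h) in u , to T-∧ Su∧uv) ∘ to T-∨
  ⇒closed : ∀ {v} → Dominated G S v → T (lookup S v ∨ any (λ u → lookup S u ∧ adj G u v) (allFin (order G)))
  ⇒closed = from T-∨ ∘ Sum.map₂ (λ (u , Su , uv) → any⁺ _ (tabulate⁺ u (from T-∧ (Su , uv))))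

data Vertex : Set where
  u₁ u₂ u₃ : Vertex
  vᵢ wᵢ    : ℕ → Vertex

data Edge : Vertex → Vertex → Set where
  u₁u₂ : Edge u₁ u₂
  u₂u₃ : Edge u₂ u₃
  u₁vᵢ : ∀ {i} → Edge u₁ (vᵢ i)
  u₃wᵢ : ∀ {i} → Edge u₃ (wᵢ i)
  vᵢwᵢ : ∀ {i j} → i ≡ j → Edge (vᵢ i) (wᵢ j)

Adjacent : Vertex → Vertex → Set
Adjacent x y = Edge x y ⊎ Edge y x

vertexOf : ℕ → ℕ → Vertex
vertexOf n 0 = u₁
vertexOf n 1 = u₂
vertexOf n 2 = u₃
vertexOf n (suc (suc (suc k))) = if k <ᵇ n then vᵢ k else wᵢ (k ∸ n)

vertexOf-v : ∀ {n k} → k < n → vertexOf n (3 ℕ.+ k) ≡ vᵢ k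
vertexOf-v {n} {k} k<n with k <ᵇ n | ℕ.<⇒<ᵇ k<n
... | true | _ = refl

vertexOf-w : ∀ n k → vertexOf n (3 ℕ.+ n ℕ.+ k) ≡ wᵢ k
vertexOf-w n k with n ℕ.+ k <ᵇ n in eq
... | true  = ⊥-elim (ℕ.m+n≮m n k (ℕ.<ᵇ⇒< (n ℕ.+ k) n (subst T (sym eq) tt)))
... | false = cong wᵢ (ℕ.m+n∸m≡n n k)

spokeEdgeᵇ : ℕ → ℕ → ℕ → ℕ → Bool
spokeEdgeᵇ n a b i =
     ((a ≡ᵇ 2) ∧ (b ≡ᵇ 3 ℕ.+ n ℕ.+ i))
  ∨ ((a ≡ᵇ 0) ∧ (b ≡ᵇ 3 ℕ.+ i))
  ∨ ((a ≡ᵇ 3 ℕ.+ i) ∧ (b ≡ᵇ 3 ℕ.+ n ℕ.+ i))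

spokeEdge-sound : ∀ n a b {i} → i < n → T (spokeEdgeᵇ n a b i) → Edge (vertexOf n a) (vertexOf n b)
spokeEdge-sound n a b {i} i<n h with to T-∨₃ h
... | inj₁ h₃w with refl , refl ← T-∧-≡ᵇ a 2 b (3 ℕ.+ n ℕ.+ i) h₃w =
  subst (Edge u₃) (sym (vertexOf-w n i)) u₃wᵢ
... | inj₂ (inj₁ h₁v) with refl , refl ← T-∧-≡ᵇ a 0 b (3 ℕ.+ i) h₁v =
  subst (Edge u₁) (sym (vertexOf-v i<n)) u₁vᵢ
... | inj₂ (inj₂ hvw) with refl , refl ← T-∧-≡ᵇ a (3 ℕ.+ i) b (3 ℕ.+ n ℕ.+ i) hvw =
  subst₂ Edge (sym (vertexOf-v i<n)) (sym (vertexOf-w n i)) (vᵢwᵢ refl)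

bookEdge-sound : ∀ n a b → T (bookEdge n a b) → Edge (vertexOf n a) (vertexOf n b)
bookEdge-sound n a b h with to T-∨₃ h
... | inj₁ h₁₂ with refl , refl ← T-∧-≡ᵇ a 0 b 1 h₁₂ = u₁u₂
... | inj₂ (inj₁ h₂₃) with refl , refl ← T-∧-≡ᵇ a 1 b 2 h₂₃ = u₂u₃
... | inj₂ (inj₂ hᵢ) with i , i∈ , hᵢ′ ← find (any⁻ _ (upTo n) hᵢ) = spokeEdge-sound n a b (∈-upTo⁻ i∈) hᵢ′

bookEdge-spoke : ∀ n a b {k} → k < n → T (spokeEdgeᵇ n a b k) → T (bookEdge n a b)
bookEdge-spoke n a b k<n h =
  from (T-∨₃ {(a ≡ᵇ 0) ∧ (b ≡ᵇ 1)} {(a ≡ᵇ 1) ∧ (b ≡ᵇ 2)})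
       (inj₂ (inj₂ (any⁺ (spokeEdgeᵇ n a b) (lose (∈-upTo⁺ k<n) h))))

spokeEdge-u₁vᵢ : ∀ n k → T (spokeEdgeᵇ n 0 (3 ℕ.+ k) k)
spokeEdge-u₁vᵢ n k = from (T-∨ {k ≡ᵇ k}) (inj₁ (≡ᵇ-refl k))

spokeEdge-u₃wᵢ : ∀ n k → T (spokeEdgeᵇ n 2 (3 ℕ.+ n ℕ.+ k) k)
spokeEdge-u₃wᵢ n k = from (T-∨ {n ℕ.+ k ≡ᵇ n ℕ.+ k}) (inj₁ (≡ᵇ-refl (n ℕ.+ k)))

spokeEdge-vᵢwᵢ : ∀ n k → T (spokeEdgeᵇ n (3 ℕ.+ k) (3 ℕ.+ n ℕ.+ k) k)
spokeEdge-vᵢwᵢ n k = from T-∧ (≡ᵇ-refl k , ≡ᵇ-refl (n ℕ.+ k))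

vᶠ wᶠ : ∀ {n} → Fin n → Fin (order (B5 n))
vᶠ {n} i = Fin.suc (Fin.suc (Fin.suc (i ↑ˡ n)))
wᶠ {n} i = Fin.suc (Fin.suc (Fin.suc (n ↑ʳ i)))

toℕ-vᶠ : ∀ {n} (i : Fin n) → toℕ (vᶠ i) ≡ 3 ℕ.+ toℕ i
toℕ-vᶠ {n} i = cong (3 ℕ.+_) (toℕ-↑ˡ i n)

toℕ-wᶠ : ∀ {n} (i : Fin n) → toℕ (wᶠ i) ≡ 3 ℕ.+ n ℕ.+ toℕ i
toℕ-wᶠ {n} i = cong (3 ℕ.+_) (toℕ-↑ʳ n i)

data View (n : ℕ) : Fin (order (B5 n)) → Vertex → Set where
  at-u₁ : View n Fin.zero u₁
  at-u₂ : View n (Fin.suc Fin.zero) u₂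
  at-u₃ : View n (Fin.suc (Fin.suc Fin.zero)) u₃
  at-vᵢ : (i : Fin n) → View n (vᶠ i) (vᵢ (toℕ i))
  at-wᵢ : (i : Fin n) → View n (wᶠ i) (wᵢ (toℕ i))

view : ∀ {n} (u : Fin (order (B5 n))) → ∃ (View n u)
view Fin.zero                   = _ , at-u₁
view (Fin.suc Fin.zero)          = _ , at-u₂
view (Fin.suc (Fin.suc Fin.zero)) = _ , at-u₃
view {n} (Fin.suc (Fin.suc (Fin.suc k))) with splitAt n k in eq
... | inj₁ i rewrite sym (splitAt⁻¹-↑ˡ eq) = _ , at-vᵢ i
... | inj₂ i rewrite sym (splitAt⁻¹-↑ʳ eq) = _ , at-wᵢ i

vertexOf-View : ∀ {n u x} → View n u x → vertexOf n (toℕ u) ≡ x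
vertexOf-View at-u₁         = refl
vertexOf-View at-u₂         = refl
vertexOf-View at-u₃         = refl
vertexOf-View {n} (at-vᵢ i) = cong (vertexOf n) (toℕ-vᶠ i) ⟨ trans ⟩ vertexOf-v (toℕ<n i)
vertexOf-View {n} (at-wᵢ i) = cong (vertexOf n) (toℕ-wᶠ i) ⟨ trans ⟩ vertexOf-w n (toℕ i)

adjacent-sound : ∀ {n u v x y} → View n u x → View n v y → T (adj (B5 n) u v) → Adjacent x y
adjacent-sound {n} {u} {v} uᵛ vᵛ =
  Sum.map (subst₂ Edge (vertexOf-View uᵛ) (vertexOf-View vᵛ) ∘ bookEdge-sound n (toℕ u) (toℕ v))
          (subst₂ Edge (vertexOf-View vᵛ) (vertexOf-View uᵛ) ∘ bookEdge-sound n (toℕ v) (toℕ u))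
  ∘ to T-∨

edge-complete : ∀ {n u v x y} → View n u x → View n v y → Edge x y → T (bookEdge n (toℕ u) (toℕ v))
edge-complete at-u₁ at-u₂ u₁u₂ = tt
edge-complete at-u₂ at-u₃ u₂u₃ = tt
edge-complete {n} at-u₁ (at-vᵢ i) u₁vᵢ =
  subst (T ∘ bookEdge n 0) (sym (toℕ-vᶠ i))
        (bookEdge-spoke n 0 (3 ℕ.+ toℕ i) (toℕ<n i) (spokeEdge-u₁vᵢ n (toℕ i)))
edge-complete {n} at-u₃ (at-wᵢ i) u₃wᵢ =
  subst (T ∘ bookEdge n 2) (sym (toℕ-wᶠ i))
        (bookEdge-spoke n 2 (3 ℕ.+ n ℕ.+ toℕ i) (toℕ<n i) (spokeEdge-u₃wᵢ n (toℕ i)))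
edge-complete {n} (at-vᵢ i) (at-wᵢ j) (vᵢwᵢ i≡j) with refl ← toℕ-injective i≡j =
  subst₂ (λ a b → T (bookEdge n a b)) (sym (toℕ-vᶠ i)) (sym (toℕ-wᶠ i))
         (bookEdge-spoke n (3 ℕ.+ toℕ i) (3 ℕ.+ n ℕ.+ toℕ i) (toℕ<n i) (spokeEdge-vᵢwᵢ n (toℕ i)))

adjacent-complete : ∀ {n u v x y} → View n u x → View n v y → Adjacent x y → T (adj (B5 n) u v)
adjacent-complete uᵛ vᵛ = from T-∨ ∘ Sum.map (edge-complete uᵛ vᵛ) (edge-complete vᵛ uᵛ)

-- Domination in B5 n is a local condition

anyᵛ : ∀ {k} → VSet k → Bool
anyᵛ []       = false
anyᵛ (b ∷ bs) = b ∨ anyᵛ bs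

T-anyᵛ : ∀ {k} (bs : VSet k) → T (anyᵛ bs) ⇔ (∃[ i ] T (lookup bs i))
T-anyᵛ bs = mk⇔ (elim bs) (λ (i , h) → intro bs i h)
  where
  elim : ∀ {k} (bs : VSet k) → T (anyᵛ bs) → ∃[ i ] T (lookup bs i)
  elim (b ∷ bs) h with to T-∨ h
  ... | inj₁ hb  = Fin.zero , hb
  ... | inj₂ hbs = let i , hi = elim bs hbs in Fin.suc i , hi
  intro : ∀ {k} (bs : VSet k) i → T (lookup bs i) → T (anyᵛ bs)
  intro (b ∷ bs) Fin.zero    h = from T-∨ (inj₁ h)
  intro (b ∷ bs) (Fin.suc i) h = from (T-∨ {b}) (inj₂ (intro bs i h))

allPairs : ∀ {k} → (Bool → Bool → Bool) → VSet k → VSet k → Bool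
allPairs g []       []       = true
allPairs g (v ∷ vs) (w ∷ ws) = g v w ∧ allPairs g vs ws

T-allPairs : ∀ {k} g (vs ws : VSet k) → T (allPairs g vs ws) ⇔ (∀ i → T (g (lookup vs i) (lookup ws i)))
T-allPairs g vs ws = mk⇔ (elim vs ws) (intro vs ws)
  where
  elim : ∀ {k} (vs ws : VSet k) → T (allPairs g vs ws) → ∀ i → T (g (lookup vs i) (lookup ws i))
  elim (v ∷ vs) (w ∷ ws) h Fin.zero    = proj₁ (to T-∧ h)
  elim (v ∷ vs) (w ∷ ws) h (Fin.suc i) = elim vs ws (proj₂ (to (T-∧ {g v w}) h)) i
  intro : ∀ {k} (vs ws : VSet k) → (∀ i → T (g (lookup vs i) (lookup ws i))) → T (allPairs g vs ws)
  intro []       []       h = tt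
  intro (v ∷ vs) (w ∷ ws) h = from T-∧ (h Fin.zero , intro vs ws (h ∘ Fin.suc))

-- vᵢ and wᵢ are dominated, where a and c say whether u₁ and u₃ lie in S.
spoke : Bool → Bool → Bool → Bool → Bool
spoke a c v w = (v ∨ a ∨ w) ∧ (w ∨ c ∨ v)

bookDominatingᵇ : ∀ {n} → Bool → Bool → Bool → VSet n → VSet n → Bool
bookDominatingᵇ a b c vs ws =
  (a ∨ b ∨ c) ∧ (a ∨ b ∨ anyᵛ vs) ∧ (c ∨ b ∨ anyᵛ ws) ∧ allPairs (spoke a c) vs ws

module _ {n : ℕ} (a b c : Bool) (vs ws : VSet n) where

  private
    S : VSet (order (B5 n))
    S = a ∷ b ∷ c ∷ vs Vec.++ ws

    lookup-vᶠ : ∀ i → lookup S (vᶠ i) ≡ lookup vs i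
    lookup-vᶠ = lookup-++ˡ vs ws

    lookup-wᶠ : ∀ i → lookup S (wᶠ i) ≡ lookup ws i
    lookup-wᶠ = lookup-++ʳ vs ws

  closedNbhdᵇ : ∀ {u x} → View n u x → Bool × Bool × Bool
  closedNbhdᵇ at-u₁     = a , b , anyᵛ vs
  closedNbhdᵇ at-u₂     = a , b , c
  closedNbhdᵇ at-u₃     = c , b , anyᵛ ws
  closedNbhdᵇ (at-vᵢ i) = lookup vs i , a , lookup ws i
  closedNbhdᵇ (at-wᵢ i) = lookup ws i , c , lookup vs i

  dominatedᵇ : ∀ {u x} → View n u x → Bool
  dominatedᵇ uᵛ = let p , q , r = closedNbhdᵇ uᵛ in p ∨ q ∨ r

  T-dominatedᵇ : ∀ {u x} (uᵛ : View n u x) →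
                 let p , q , r = closedNbhdᵇ uᵛ in T (dominatedᵇ uᵛ) ⇔ (T p ⊎ T q ⊎ T r)
  T-dominatedᵇ uᵛ = T-∨₃

  member⇒dominatedᵇ : ∀ {u x} (uᵛ : View n u x) → T (lookup S u) → T (dominatedᵇ uᵛ)
  member⇒dominatedᵇ at-u₁     s = from (T-dominatedᵇ at-u₁) (inj₁ s)
  member⇒dominatedᵇ at-u₂     s = from (T-dominatedᵇ at-u₂) (inj₂ (inj₁ s))
  member⇒dominatedᵇ at-u₃     s = from (T-dominatedᵇ at-u₃) (inj₁ s)
  member⇒dominatedᵇ (at-vᵢ i) s = from (T-dominatedᵇ (at-vᵢ i)) (inj₁ (subst T (lookup-vᶠ i) s))
  member⇒dominatedᵇ (at-wᵢ i) s = from (T-dominatedᵇ (at-wᵢ i)) (inj₁ (subst T (lookup-wᶠ i) s))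

  neighbour⇒dominatedᵇ : ∀ {u v x y} (uᵛ : View n u x) (vᵛ : View n v y) →
                         Adjacent x y → T (lookup S u) → T (dominatedᵇ vᵛ)
  neighbour⇒dominatedᵇ at-u₁     at-u₂     (inj₁ u₁u₂) s = from (T-dominatedᵇ at-u₂) (inj₁ s)
  neighbour⇒dominatedᵇ at-u₂     at-u₃     (inj₁ u₂u₃) s = from (T-dominatedᵇ at-u₃) (inj₂ (inj₁ s))
  neighbour⇒dominatedᵇ at-u₁     (at-vᵢ i) (inj₁ u₁vᵢ) s = from (T-dominatedᵇ (at-vᵢ i)) (inj₂ (inj₁ s))
  neighbour⇒dominatedᵇ at-u₃     (at-wᵢ i) (inj₁ u₃wᵢ) s = from (T-dominatedᵇ (at-wᵢ i)) (inj₂ (inj₁ s))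
  neighbour⇒dominatedᵇ (at-vᵢ i) (at-wᵢ j) (inj₁ (vᵢwᵢ i≡j)) s with refl ← toℕ-injective i≡j =
    from (T-dominatedᵇ (at-wᵢ j)) (inj₂ (inj₂ (subst T (lookup-vᶠ i) s)))
  neighbour⇒dominatedᵇ at-u₂     at-u₁     (inj₂ u₁u₂) s = from (T-dominatedᵇ at-u₁) (inj₂ (inj₁ s))
  neighbour⇒dominatedᵇ at-u₃     at-u₂     (inj₂ u₂u₃) s = from (T-dominatedᵇ at-u₂) (inj₂ (inj₂ s))
  neighbour⇒dominatedᵇ (at-vᵢ i) at-u₁     (inj₂ u₁vᵢ) s =
    from (T-dominatedᵇ at-u₁) (inj₂ (inj₂ (from (T-anyᵛ vs) (i , subst T (lookup-vᶠ i) s))))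
  neighbour⇒dominatedᵇ (at-wᵢ i) at-u₃     (inj₂ u₃wᵢ) s =
    from (T-dominatedᵇ at-u₃) (inj₂ (inj₂ (from (T-anyᵛ ws) (i , subst T (lookup-wᶠ i) s))))
  neighbour⇒dominatedᵇ (at-wᵢ j) (at-vᵢ i) (inj₂ (vᵢwᵢ i≡j)) s with refl ← toℕ-injective i≡j =
    from (T-dominatedᵇ (at-vᵢ i)) (inj₂ (inj₂ (subst T (lookup-wᶠ i) s)))

  dominated⇒dominatedᵇ : ∀ {v y} (vᵛ : View n v y) → Dominated (B5 n) S v → T (dominatedᵇ vᵛ)
  dominated⇒dominatedᵇ vᵛ (inj₁ s)            = member⇒dominatedᵇ vᵛ s
  dominated⇒dominatedᵇ vᵛ (inj₂ (u , s , uv)) =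
    let _ , uᵛ = view u in neighbour⇒dominatedᵇ uᵛ vᵛ (adjacent-sound uᵛ vᵛ uv) s

  by-neighbour : ∀ {u v x y} → View n u x → View n v y → Adjacent x y → T (lookup S u) → Dominated (B5 n) S v
  by-neighbour {u} uᵛ vᵛ xy s = inj₂ (u , s , adjacent-complete uᵛ vᵛ xy)

  dominatedᵇ⇒dominated : ∀ {v y} (vᵛ : View n v y) → T (dominatedᵇ vᵛ) → Dominated (B5 n) S v
  dominatedᵇ⇒dominated at-u₁ h with to T-∨₃ h
  ... | inj₁ s        = inj₁ s
  ... | inj₂ (inj₁ s) = by-neighbour at-u₂ at-u₁ (inj₂ u₁u₂) s
  ... | inj₂ (inj₂ s) = let i , sᵢ = to (T-anyᵛ vs) s in
                        by-neighbour (at-vᵢ i) at-u₁ (inj₂ u₁vᵢ) (subst T (sym (lookup-vᶠ i)) sᵢ)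
  dominatedᵇ⇒dominated at-u₂ h with to T-∨₃ h
  ... | inj₁ s        = by-neighbour at-u₁ at-u₂ (inj₁ u₁u₂) s
  ... | inj₂ (inj₁ s) = inj₁ s
  ... | inj₂ (inj₂ s) = by-neighbour at-u₃ at-u₂ (inj₂ u₂u₃) s
  dominatedᵇ⇒dominated at-u₃ h with to T-∨₃ h
  ... | inj₁ s        = inj₁ s
  ... | inj₂ (inj₁ s) = by-neighbour at-u₂ at-u₃ (inj₁ u₂u₃) s
  ... | inj₂ (inj₂ s) = let i , sᵢ = to (T-anyᵛ ws) s in
                        by-neighbour (at-wᵢ i) at-u₃ (inj₂ u₃wᵢ) (subst T (sym (lookup-wᶠ i)) sᵢ)
  dominatedᵇ⇒dominated (at-vᵢ i) h with to T-∨₃ h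
  ... | inj₁ s        = inj₁ (subst T (sym (lookup-vᶠ i)) s)
  ... | inj₂ (inj₁ s) = by-neighbour at-u₁ (at-vᵢ i) (inj₁ u₁vᵢ) s
  ... | inj₂ (inj₂ s) = by-neighbour (at-wᵢ i) (at-vᵢ i) (inj₂ (vᵢwᵢ refl)) (subst T (sym (lookup-wᶠ i)) s)
  dominatedᵇ⇒dominated (at-wᵢ i) h with to T-∨₃ h
  ... | inj₁ s        = inj₁ (subst T (sym (lookup-wᶠ i)) s)
  ... | inj₂ (inj₁ s) = by-neighbour at-u₃ (at-wᵢ i) (inj₁ u₃wᵢ) s
  ... | inj₂ (inj₂ s) = by-neighbour (at-vᵢ i) (at-wᵢ i) (inj₁ (vᵢwᵢ refl)) (subst T (sym (lookup-vᶠ i)) s)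

  bookDominatingᵇ⇒ : T (bookDominatingᵇ a b c vs ws) → ∀ {v y} (vᵛ : View n v y) → T (dominatedᵇ vᵛ)
  bookDominatingᵇ⇒ h with to (T-∧ {dominatedᵇ at-u₂}) h
  ... | h₂ , h′ with to (T-∧ {dominatedᵇ at-u₁}) h′
  ... | h₁ , h″ with to (T-∧ {dominatedᵇ at-u₃}) h″
  ... | h₃ , hᵢ = λ { at-u₁     → h₁
                    ; at-u₂     → h₂
                    ; at-u₃     → h₃
                    ; (at-vᵢ i) → proj₁ (spokeᵢ i)
                    ; (at-wᵢ i) → proj₂ (spokeᵢ i) }
    where
    spokeᵢ : ∀ i → T (dominatedᵇ (at-vᵢ i)) × T (dominatedᵇ (at-wᵢ i))
    spokeᵢ i = to T-∧ (to (T-allPairs (spoke a c) vs ws) hᵢ i)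

  bookDominatingᵇ⇐ : (∀ {v y} (vᵛ : View n v y) → T (dominatedᵇ vᵛ)) → T (bookDominatingᵇ a b c vs ws)
  bookDominatingᵇ⇐ h =
    from (T-∧ {dominatedᵇ at-u₂}) (h at-u₂ ,
    from (T-∧ {dominatedᵇ at-u₁}) (h at-u₁ ,
    from (T-∧ {dominatedᵇ at-u₃}) (h at-u₃ ,
    from (T-allPairs (spoke a c) vs ws) (λ i → from (T-∧ {dominatedᵇ (at-vᵢ i)}) (h (at-vᵢ i) , h (at-wᵢ i))))))

  isDominating-B5 : isDominating (B5 n) S ≡ bookDominatingᵇ a b c vs ws
  isDominating-B5 = T-⇔⇒≡ (mk⇔
    (λ h → bookDominatingᵇ⇐ (λ {v} vᵛ → dominated⇒dominatedᵇ vᵛ (to (isDominating⇔ (B5 n) S) h v)))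
    (λ h → from (isDominating⇔ (B5 n) S) (λ v → let _ , vᵛ = view v in
                                                   dominatedᵇ⇒dominated vᵛ (bookDominatingᵇ⇒ h vᵛ))))

-- Generating functions of spoke configurations

withoutV withoutW : (Bool → Bool → Bool) → Bool → Bool → Bool
withoutV g v w = not v ∧ g v w
withoutW g v w = not w ∧ g v w

allPairs-withoutV : ∀ {k} g (vs ws : VSet k) → allPairs (withoutV g) vs ws ≡ not (anyᵛ vs) ∧ allPairs g vs ws
allPairs-withoutV g []           []       = refl
allPairs-withoutV g (true  ∷ vs) (w ∷ ws) = refl
allPairs-withoutV g (false ∷ vs) (w ∷ ws) =
  cong (g false w ∧_) (allPairs-withoutV g vs ws) ⟨ trans ⟩ ∧-swap (g false w) (not (anyᵛ vs)) (allPairs g vs ws)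

allPairs-withoutW : ∀ {k} g (vs ws : VSet k) → allPairs (withoutW g) vs ws ≡ not (anyᵛ ws) ∧ allPairs g vs ws
allPairs-withoutW g []       []           = refl
allPairs-withoutW g (v ∷ vs) (true  ∷ ws) = refl
allPairs-withoutW g (v ∷ vs) (false ∷ ws) =
  cong (g v false ∧_) (allPairs-withoutW g vs ws) ⟨ trans ⟩ ∧-swap (g v false) (not (anyᵛ ws)) (allPairs g vs ws)

module _ (x : ℤ) where

  xᵇ : Bool → ℤ
  xᵇ true  = x
  xᵇ false = + 1

  ^-size-∷ : ∀ {k} b (bs : VSet k) → x ^ size (b ∷ bs) ≡ xᵇ b * x ^ size bs
  ^-size-∷ true  bs = refl
  ^-size-∷ false bs = sym (ℤ.*-identityˡ _)

  monomial : ∀ {k} → VSet k → VSet k → ℤ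
  monomial vs ws = x ^ size vs * x ^ size ws

  pairTerm : ∀ {k} → (Bool → Bool → Bool) → VSet k → VSet k → ℤ
  pairTerm g vs ws = ⟦ allPairs g vs ws ⟧ * monomial vs ws

  pairSum : (k : ℕ) → (Bool → Bool → Bool) → ℤ
  pairSum k g = ∑ (allSubsets k) λ vs → ∑ (allSubsets k) λ ws → pairTerm g vs ws

  localTerm : (Bool → Bool → Bool) → Bool → Bool → ℤ
  localTerm g v w = ⟦ g v w ⟧ * (xᵇ v * xᵇ w)

  localWeight : (Bool → Bool → Bool) → ℤ
  localWeight g = ∑𝔹 λ v → ∑𝔹 λ w → localTerm g v w

  pairTerm-∷ : ∀ {k} g v w (vs ws : VSet k) →
               pairTerm g (v ∷ vs) (w ∷ ws) ≡ localTerm g v w * pairTerm g vs ws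
  pairTerm-∷ g v w vs ws =
    cong₂ _*_ (⟦∧⟧ (g v w) (allPairs g vs ws)) (cong₂ _*_ (^-size-∷ v vs) (^-size-∷ w ws))
    ⟨ trans ⟩ regroup ⟦ g v w ⟧ ⟦ allPairs g vs ws ⟧ (xᵇ v) (xᵇ w) (x ^ size vs) (x ^ size ws)
    where
    regroup : ∀ p q s t m m′ → p * q * (s * m * (t * m′)) ≡ p * (s * t) * (q * (m * m′))
    regroup = solve-∀

  pairSum-suc : ∀ k g → pairSum (suc k) g ≡ localWeight g * pairSum k g
  pairSum-suc k g = begin
      pairSum (suc k) g
    ≡⟨ ∑-allSubsets-suc k _ ⟩
      ∑𝔹 (λ v → ∑ (allSubsets k) λ vs → ∑ (allSubsets (suc k)) (pairTerm g (v ∷ vs)))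
    ≡⟨ ∑𝔹-cong (λ v → ∑-cong (allSubsets k) (λ vs → ∑-allSubsets-suc k (pairTerm g (v ∷ vs)))) ⟩
      ∑𝔹 (λ v → ∑ (allSubsets k) λ vs → ∑𝔹 λ w → ∑ (allSubsets k) (pairTerm g (v ∷ vs) ∘ (w ∷_)))
    ≡⟨ ∑𝔹-cong (λ v → ∑-∑𝔹 (allSubsets k) (λ vs w → ∑ (allSubsets k) (pairTerm g (v ∷ vs) ∘ (w ∷_)))) ⟩
      ∑𝔹 (λ v → ∑𝔹 λ w → ∑ (allSubsets k) λ vs → ∑ (allSubsets k) (pairTerm g (v ∷ vs) ∘ (w ∷_)))
    ≡⟨ ∑𝔹-cong (λ v → ∑𝔹-cong (λ w → factor v w)) ⟩
      ∑𝔹 (λ v → ∑𝔹 λ w → localTerm g v w * pairSum k g)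
    ≡⟨ ∑𝔹-cong (λ v → ∑𝔹-*ʳ (localTerm g v) (pairSum k g)) ⟨ trans ⟩
       ∑𝔹-*ʳ (λ v → ∑𝔹 (localTerm g v)) (pairSum k g) ⟩
      localWeight g * pairSum k g
    ∎
    where
    open ≡-Reasoning
    factor : ∀ v w → ∑ (allSubsets k) (λ vs → ∑ (allSubsets k) (pairTerm g (v ∷ vs) ∘ (w ∷_)))
                     ≡ localTerm g v w * pairSum k g
    factor v w =
      ∑-cong (allSubsets k) (λ vs → ∑-cong (allSubsets k) (pairTerm-∷ g v w vs)
                                     ⟨ trans ⟩ ∑-* (allSubsets k) (localTerm g v w) (pairTerm g vs))
      ⟨ trans ⟩ ∑-* (allSubsets k) (localTerm g v w) (λ vs → ∑ (allSubsets k) (pairTerm g vs))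

  pairSum≡localWeight^ : ∀ k g → pairSum k g ≡ localWeight g ^ k
  pairSum≡localWeight^ zero    g = refl
  pairSum≡localWeight^ (suc k) g = pairSum-suc k g ⟨ trans ⟩ cong (localWeight g *_) (pairSum≡localWeight^ k g)

  pairSum-power : ∀ k g {w} → localWeight g ≡ w → pairSum k g ≡ w ^ k
  pairSum-power k g refl = pairSum≡localWeight^ k g

  pairSum-anyᵛˡ : ∀ k g → ∑ (allSubsets k) (λ vs → ∑ (allSubsets k) λ ws → ⟦ anyᵛ vs ∧ allPairs g vs ws ⟧ * monomial vs ws)
                          ≡ pairSum k g - pairSum k (withoutV g)
  pairSum-anyᵛˡ k g =
    ∑-cong (allSubsets k) (λ vs → ∑-cong (allSubsets k) (complement vs)
                                  ⟨ trans ⟩ ∑-- (allSubsets k) (pairTerm g vs) (pairTerm (withoutV g) vs))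
    ⟨ trans ⟩ ∑-- (allSubsets k) _ _
    where
    complement : ∀ vs ws → ⟦ anyᵛ vs ∧ allPairs g vs ws ⟧ * monomial vs ws ≡ pairTerm g vs ws - pairTerm (withoutV g) vs ws
    complement vs ws = ⟦∧⟧-complement (anyᵛ vs) (allPairs g vs ws) (monomial vs ws)
      ⟨ trans ⟩ cong (λ p → pairTerm g vs ws - ⟦ p ⟧ * monomial vs ws) (sym (allPairs-withoutV g vs ws))

  pairSum-anyᵛʳ : ∀ k g → ∑ (allSubsets k) (λ vs → ∑ (allSubsets k) λ ws → ⟦ anyᵛ ws ∧ allPairs g vs ws ⟧ * monomial vs ws)
                          ≡ pairSum k g - pairSum k (withoutW g)
  pairSum-anyᵛʳ k g =
    ∑-cong (allSubsets k) (λ vs → ∑-cong (allSubsets k) (complement vs)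
                                  ⟨ trans ⟩ ∑-- (allSubsets k) (pairTerm g vs) (pairTerm (withoutW g) vs))
    ⟨ trans ⟩ ∑-- (allSubsets k) _ _
    where
    complement : ∀ vs ws → ⟦ anyᵛ ws ∧ allPairs g vs ws ⟧ * monomial vs ws ≡ pairTerm g vs ws - pairTerm (withoutW g) vs ws
    complement vs ws = ⟦∧⟧-complement (anyᵛ ws) (allPairs g vs ws) (monomial vs ws)
      ⟨ trans ⟩ cong (λ p → pairTerm g vs ws - ⟦ p ⟧ * monomial vs ws) (sym (allPairs-withoutW g vs ws))

  localWeight≡ : ∀ g → localWeight g ≡ ⟦ g true true ⟧ * (x * x) + (⟦ g true false ⟧ + ⟦ g false true ⟧) * x + ⟦ g false false ⟧
  localWeight≡ g = expand x ⟦ g true true ⟧ ⟦ g true false ⟧ ⟦ g false true ⟧ ⟦ g false false ⟧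
    where
    expand : ∀ x p q r s → p * (x * x) + q * (x * + 1) + (r * (+ 1 * x) + s * (+ 1 * + 1))
                           ≡ p * (x * x) + (q + r) * x + s
    expand = solve-∀

  localWeight-spoke-both : localWeight (spoke true true) ≡ (x + + 1) ^ 2
  localWeight-spoke-both = localWeight≡ (spoke true true) ⟨ trans ⟩ square x
    where
    -- (x + 1) ^ 2 unfolded: the ring solver does not handle _^_.
    square : ∀ x → + 1 * (x * x) + (+ 1 + + 1) * x + + 1 ≡ (x + + 1) * ((x + + 1) * + 1)
    square = solve-∀

  private
    three-pairs : ∀ x → + 1 * (x * x) + (+ 1 + + 1) * x + + 0 ≡ x * (x * + 1) + + 2 * x
    three-pairs = solve-∀

  localWeight-spoke : ∀ a c → a ∧ c ≡ false → localWeight (spoke a c) ≡ x ^ 2 + + 2 * x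
  localWeight-spoke true  false _ = localWeight≡ (spoke true false) ⟨ trans ⟩ three-pairs x
  localWeight-spoke false true  _ = localWeight≡ (spoke false true) ⟨ trans ⟩ three-pairs x
  localWeight-spoke false false _ = localWeight≡ (spoke false false) ⟨ trans ⟩ three-pairs x

  localWeight-withoutW-spoke : localWeight (withoutW (spoke true false)) ≡ x
  localWeight-withoutW-spoke = localWeight≡ (withoutW (spoke true false)) ⟨ trans ⟩ single-pair x
    where
    single-pair : ∀ x → + 0 * (x * x) + (+ 1 + + 0) * x + + 0 ≡ x
    single-pair = solve-∀

  localWeight-withoutV-spoke : localWeight (withoutV (spoke false true)) ≡ x
  localWeight-withoutV-spoke = localWeight≡ (withoutV (spoke false true)) ⟨ trans ⟩ single-pair x
    where
    single-pair : ∀ x → + 0 * (x * x) + (+ 0 + + 1) * x + + 0 ≡ x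
    single-pair = solve-∀

-- The eight cases of (a, b, c); P, Q and X stand for ((x + 1)²)ⁿ, (x² + 2x)ⁿ and xⁿ.
blockValue : (P Q X : ℤ) → Bool → Bool → Bool → ℤ
blockValue P Q X true  true  true  = P
blockValue P Q X true  true  false = Q
blockValue P Q X true  false true  = P
blockValue P Q X true  false false = Q - X
blockValue P Q X false true  true  = Q
blockValue P Q X false true  false = Q
blockValue P Q X false false true  = Q - X
blockValue P Q X false false false = + 0

module _ (n : ℕ) (x : ℤ) where

  block : Bool → Bool → Bool → ℤ
  block a b c = ∑ (allSubsets n) λ vs → ∑ (allSubsets n) λ ws → ⟦ bookDominatingᵇ a b c vs ws ⟧ * monomial x vs ws

  block≡blockValue : ∀ a b c → block a b c ≡ blockValue (((x + + 1) ^ 2) ^ n) ((x ^ 2 + + 2 * x) ^ n) (x ^ n) a b c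
  block≡blockValue true  true  true  = pairSum-power x n _ (localWeight-spoke-both x)
  block≡blockValue true  true  false = pairSum-power x n _ (localWeight-spoke x true false refl)
  block≡blockValue true  false true  = pairSum-power x n _ (localWeight-spoke-both x)
  block≡blockValue true  false false =
    pairSum-anyᵛʳ x n (spoke true false)
    ⟨ trans ⟩ cong₂ _-_ (pairSum-power x n _ (localWeight-spoke x true false refl))
                        (pairSum-power x n _ (localWeight-withoutW-spoke x))
  block≡blockValue false true  true  = pairSum-power x n _ (localWeight-spoke x false true refl)
  block≡blockValue false true  false = pairSum-power x n _ (localWeight-spoke x false false refl)
  block≡blockValue false false true  =
    pairSum-anyᵛˡ x n (spoke false true)
    ⟨ trans ⟩ cong₂ _-_ (pairSum-power x n _ (localWeight-spoke x false true refl))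
                        (pairSum-power x n _ (localWeight-withoutV-spoke x))
  block≡blockValue false false false = ∑-zero (allSubsets n) (λ _ → ∑-zero (allSubsets n) (λ _ → refl))

  ^-size-bookSet : ∀ a b c (vs ws : VSet n) →
                   x ^ size (a ∷ b ∷ c ∷ vs Vec.++ ws) ≡ xᵇ x a * xᵇ x b * xᵇ x c * monomial x vs ws
  ^-size-bookSet a b c vs ws = begin
      x ^ size (a ∷ b ∷ c ∷ vs Vec.++ ws)
    ≡⟨ ^-size-∷ x a _ ⟨ trans ⟩ cong (xᵇ x a *_) (^-size-∷ x b _ ⟨ trans ⟩ cong (xᵇ x b *_) (^-size-∷ x c (vs Vec.++ ws))) ⟩
      xᵇ x a * (xᵇ x b * (xᵇ x c * x ^ size (vs Vec.++ ws)))
    ≡⟨ cong (λ m → xᵇ x a * (xᵇ x b * (xᵇ x c * m)))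
            (cong (x ^_) (size-++ vs ws) ⟨ trans ⟩ ℤ.^-distribˡ-+-* x (size vs) (size ws)) ⟩
      xᵇ x a * (xᵇ x b * (xᵇ x c * monomial x vs ws))
    ≡⟨ reassoc (xᵇ x a) (xᵇ x b) (xᵇ x c) (monomial x vs ws) ⟩
      xᵇ x a * xᵇ x b * xᵇ x c * monomial x vs ws
    ∎
    where
    open ≡-Reasoning
    reassoc : ∀ p q r m → p * (q * (r * m)) ≡ p * q * r * m
    reassoc = solve-∀

  D-B5≡∑blocks : D (B5 n) x ≡ ∑𝔹 λ a → ∑𝔹 λ b → ∑𝔹 λ c → xᵇ x a * xᵇ x b * xᵇ x c * block a b c
  D-B5≡∑blocks = begin
      D (B5 n) x
    ≡⟨ D≡∑dominating (B5 n) x ⟩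
      ∑ (allSubsets (order (B5 n))) weight
    ≡⟨ ∑-allSubsets-suc _ weight ⟨ trans ⟩
       ∑𝔹-cong (λ a → ∑-allSubsets-suc _ (weight ∘ (a ∷_)) ⟨ trans ⟩
                      ∑𝔹-cong (λ b → ∑-allSubsets-suc _ (weight ∘ (a ∷_) ∘ (b ∷_)))) ⟩
      ∑𝔹 (λ a → ∑𝔹 λ b → ∑𝔹 λ c → ∑ (allSubsets (n ℕ.+ n)) (λ s → weight (a ∷ b ∷ c ∷ s)))
    ≡⟨ ∑𝔹-cong (λ a → ∑𝔹-cong λ b → ∑𝔹-cong λ c → split a b c) ⟩
      ∑𝔹 (λ a → ∑𝔹 λ b → ∑𝔹 λ c → xᵇ x a * xᵇ x b * xᵇ x c * block a b c)
    ∎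
    where
    open ≡-Reasoning
    weight : VSet (order (B5 n)) → ℤ
    weight S = ⟦ isDominating (B5 n) S ⟧ * x ^ size S
    term : Bool → Bool → Bool → VSet n → VSet n → ℤ
    term a b c vs ws = ⟦ bookDominatingᵇ a b c vs ws ⟧ * monomial x vs ws
    weight≡ : ∀ a b c vs ws → weight (a ∷ b ∷ c ∷ vs Vec.++ ws) ≡ xᵇ x a * xᵇ x b * xᵇ x c * term a b c vs ws
    weight≡ a b c vs ws =
      cong₂ _*_ (cong ⟦_⟧ (isDominating-B5 a b c vs ws)) (^-size-bookSet a b c vs ws)
      ⟨ trans ⟩ swap ⟦ bookDominatingᵇ a b c vs ws ⟧ (xᵇ x a * xᵇ x b * xᵇ x c) (monomial x vs ws)
      where
      swap : ∀ d k m → d * (k * m) ≡ k * (d * m)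
      swap = solve-∀
    split : ∀ a b c → ∑ (allSubsets (n ℕ.+ n)) (λ s → weight (a ∷ b ∷ c ∷ s))
                      ≡ xᵇ x a * xᵇ x b * xᵇ x c * block a b c
    split a b c = let k = xᵇ x a * xᵇ x b * xᵇ x c in
      ∑-allSubsets-++ n n (λ s → weight (a ∷ b ∷ c ∷ s))
      ⟨ trans ⟩ ∑-cong (allSubsets n) (λ vs → ∑-cong (allSubsets n) (weight≡ a b c vs)
                                              ⟨ trans ⟩ ∑-* (allSubsets n) k (term a b c vs))
      ⟨ trans ⟩ ∑-* (allSubsets n) k (λ vs → ∑ (allSubsets n) (term a b c vs))

∑blocks-closed-form : ∀ x P Q X →
  (∑𝔹 λ a → ∑𝔹 λ b → ∑𝔹 λ c → xᵇ x a * xᵇ x b * xᵇ x c * blockValue P Q X a b c)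
  ≡ x ^ 2 * ((x + + 1) * P) - + 2 * (x * X) + Q * (+ 2 * x ^ 2 + + 3 * x)
∑blocks-closed-form = expanded
  where
  -- The left-hand side with ∑𝔹 and xᵇ unfolded, so that the ring solver sees a polynomial.
  expanded : ∀ x P Q X →
    ((x * x * x * P + x * x * + 1 * Q) + (x * + 1 * x * P + x * + 1 * + 1 * (Q - X)))
    + ((+ 1 * x * x * Q + + 1 * x * + 1 * Q) + (+ 1 * + 1 * x * (Q - X) + + 1 * + 1 * + 1 * + 0))
    ≡ x * (x * + 1) * ((x + + 1) * P) - + 2 * (x * X) + Q * (+ 2 * (x * (x * + 1)) + + 3 * x)
  expanded = solve-∀

theorem3p4 : (n : ℕ) → n ≥ 1 → (x : ℤ) →
    D (B5 n) x ≡ (x ^ 2) * ((x + + 1) ^ (2 Data.Nat.* n Data.Nat.+ 1))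
    - (+ 2) * (x ^ (n Data.Nat.+ 1))
    + ((x ^ 2 + (+ 2) * x) ^ n) * ((+ 2) * (x ^ 2) + (+ 3) * x)
theorem3p4 n _ x = begin
    D (B5 n) x
  ≡⟨ D-B5≡∑blocks n x ⟩
    (∑𝔹 λ a → ∑𝔹 λ b → ∑𝔹 λ c → xᵇ x a * xᵇ x b * xᵇ x c * block n x a b c)
  ≡⟨ ∑𝔹-cong (λ a → ∑𝔹-cong λ b → ∑𝔹-cong λ c →
       cong (xᵇ x a * xᵇ x b * xᵇ x c *_) (block≡blockValue n x a b c)) ⟩
    (∑𝔹 λ a → ∑𝔹 λ b → ∑𝔹 λ c → xᵇ x a * xᵇ x b * xᵇ x c * blockValue P Q X a b c)
  ≡⟨ ∑blocks-closed-form x P Q X ⟩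
    x ^ 2 * ((x + + 1) * P) - + 2 * (x * X) + Q * (+ 2 * x ^ 2 + + 3 * x)
  ≡⟨ cong₂ (λ p q → x ^ 2 * p - + 2 * q + Q * (+ 2 * x ^ 2 + + 3 * x)) odd-power (x ^-suc n) ⟩
    x ^ 2 * (x + + 1) ^ (2 ℕ.* n ℕ.+ 1) - + 2 * x ^ (n ℕ.+ 1) + Q * (+ 2 * x ^ 2 + + 3 * x)
  ∎
  where
  open ≡-Reasoning
  P Q X : ℤ
  P = ((x + + 1) ^ 2) ^ n
  Q = (x ^ 2 + + 2 * x) ^ n
  X = x ^ n
  _^-suc_ : ∀ y m → y * y ^ m ≡ y ^ (m ℕ.+ 1)
  y ^-suc m = cong (y ^_) (ℕ.+-comm 1 m)
  odd-power : (x + + 1) * P ≡ (x + + 1) ^ (2 ℕ.* n ℕ.+ 1)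
  odd-power = cong ((x + + 1) *_) (ℤ.^-*-assoc (x + + 1) 2 n) ⟨ trans ⟩ ((x + + 1) ^-suc (2 ℕ.* n))
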